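{- (CAT property.) There is a constant $K$ such that for every $n\ge1$, the total execution time of $\textsc{Generate}()$ (described in the context) with parameter $n$ is at most $K\cdot O_n$, where $O_n$ is the number of rooted trivalent diagrams it outputs (the number of calls to $\textsc{Output}$). Equivalently, the average time spent by the generating algorithm to produce each structure is bounded independently of $n$ and of the size of the structures.
   Context: Cost model: each elementary operation (assignment, comparison, array access, integer arithmetic, each stack primitive $\textsc{Push}$, $\textsc{Pop}$, $\textsc{StackIsEmpty}$, $\textsc{Mask}$, $\textsc{Reveal}$, each step of iterating over the stack, and each procedure call) takes constant time, and each call of the user-supplied procedure $\textsc{Output}()$ takes constant time. Generating algorithm with parameter $n\ge1$ (it outputs the rooted trivalent diagrams, encoded as pairs of permutations $s_0=\sigma_\bullet$, $s_1=\sigma_\circ$ of $\{1,\dots,c-1\}$ rooted at $1$): global counter $c$, arrays $s_0,s_1:\{1..n\}\to\{1..n\}$, stack $S$ (initially empty) with $\textsc{Push}$, $\textsc{Pop}$ (top element), $\textsc{StackIsEmpty}$, and $\textsc{Mask}(t)/\textsc{Reveal}(t)$ (temporarily remove $t$ from $S$ / reinsert it at the same position). $\textsc{Generate}()$: if $n\ge1$: $c\leftarrow2$; $s_0[1]\leftarrow1$; $\textsc{Dispatch}(1)$. Then if $n\ge3$: $c\leftarrow4$; $s_0[1]\leftarrow2$; $s_0[2]\leftarrow3$; $s_0[3]\leftarrow1$; $\textsc{Push}(1)$; $\textsc{Push}(2)$; $\textsc{Dispatch}(3)$. $\textsc{Dispatch}(s)$: $\textsc{TryClosedWhite}(s)$;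 if $c+3\le n+1$ then $\textsc{TryForward}(s)$; if $c+1\le n+1$ then $\textsc{TryClosedBlack}(s)$; for each $t$ currently in $S$: $\textsc{Mask}(t)$; $\textsc{TryBackward}(s,t)$; $\textsc{Reveal}(t)$. $\textsc{TryClosedWhite}(s)$: $s_1[s]\leftarrow s$; $\textsc{Recurse}()$. $\textsc{TryForward}(s)$: $s_0[c]\leftarrow c+1$; $s_0[c+1]\leftarrow c+2$; $s_0[c+2]\leftarrow c$; $s_1[s]\leftarrow c$; $s_1[c]\leftarrow s$; $\textsc{Push}(c+1)$; $\textsc{Push}(c+2)$; $c\leftarrow c+3$; $\textsc{Recurse}()$; $c\leftarrow c-3$; $\textsc{Pop}()$; $\textsc{Pop}()$. $\textsc{TryClosedBlack}(s)$: $s_1[s]\leftarrow c$; $s_1[c]\leftarrow s$; $s_0[c]\leftarrow c$; $c\leftarrow c+1$; $\textsc{Recurse}()$; $c\leftarrow c-1$. $\textsc{TryBackward}(s,t)$: $s_1[s]\leftarrow t$; $s_1[t]\leftarrow s$; $\textsc{Recurse}()$. $\textsc{Recurse}()$: if $S$ empty then $\textsc{Output}()$; else $k\leftarrow\textsc{Pop}()$; $\textsc{Dispatch}(k)$; $\textsc{Push}(k)$. -}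

module Defs where

-- A faithful functional model of the procedure Generate() with parameter n,
-- instrumented with the unit-cost model of the paper: every elementary
-- operation (assignment, comparison, array access, integer arithmetic,
-- Push, Pop, StackIsEmpty, Mask, Reveal, each step of iterating over the
-- stack, each procedure call, each call of Output) costs 1.
-- The whole machine state (c, s0, s1, S) is threaded through the run.
-- Termination is handled by a fuel argument; running out of fuel yields
-- 'nothing', so a result 'just (T , O)' certifies that the run terminated,
-- with total time T and O calls to Output.

open import Data.Nat using (ℕ; zero; suc; _+_; _*_; _∸_; _≤ᵇ_; _≡ᵇ_)
open import Data.Bool using (Bool; true; false; if_then_else_)
open import Data.List using (List; []; _∷_)
open import Data.Maybe using (Maybe; just; nothing)
import Data.Maybe
open import Data.Product using (_×_; _,_)

record State : Set where
  constructor mkState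
  field
    c  : ℕ
    s0 : ℕ → ℕ
    s1 : ℕ → ℕ
    S  : List ℕ          -- the stack, top element first
open State

upd : (ℕ → ℕ) → ℕ → ℕ → (ℕ → ℕ)
upd a i v j = if i ≡ᵇ j then v else a j

-- Mask(t): remove (the first occurrence of) t from the stack, remembering
-- its position;  Reveal(t): reinsert t at that same position.
removeFirst : ℕ → List ℕ → ℕ × List ℕ
removeFirst t [] = 0 , []
removeFirst t (x ∷ xs) with t ≡ᵇ x
... | true = 0 , xs
... | false with removeFirst t xs
...   | p , ys = suc p , x ∷ ys

insertAt : ℕ → ℕ → List ℕ → List ℕ
insertAt zero t xs = t ∷ xs
insertAt (suc p) t [] = t ∷ []
insertAt (suc p) t (x ∷ xs) = x ∷ insertAt p t xs

popS : List ℕ → List ℕ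
popS [] = []
popS (_ ∷ xs) = xs

-- A computation: from a state, either fuel exhaustion (nothing) or the
-- final state together with (time spent , number of Output calls).
Comp : Set
Comp = State → Maybe (State × ℕ × ℕ)

infixr 4 _⨟_
_⨟_ : Comp → Comp → Comp
(p ⨟ q) st with p st
... | nothing = nothing
... | just (st₁ , t₁ , o₁) with q st₁
...   | nothing = nothing
...   | just (st₂ , t₂ , o₂) = just (st₂ , t₁ + t₂ , o₁ + o₂)

act : ℕ → (State → State) → Comp
act k f st = just (f st , k , 0)

tick : ℕ → Comp
tick k = act k (λ st → st)

output : Comp
output st = just (st , 1 , 1)

module Algorithm (n : ℕ) where

  mutual
    recurse : ℕ → Comp
    recurse zero = λ _ → nothing
    recurse (suc f) st with S st
    ... | [] = (tick 2 ⨟ output) st                     -- call, StackIsEmpty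
    ... | k ∷ rest =
      (act 4 (λ s → record s { S = rest })               -- call, StackIsEmpty, Pop, assignment
       ⨟ dispatch f k
       ⨟ act 1 (λ s → record s { S = k ∷ S s })) st

    dispatch : ℕ → ℕ → Comp
    dispatch f s =
      tick 1                                             -- call
      ⨟ tryClosedWhite f s
      ⨟ tick 3                                           -- c+3, n+1, comparison
      ⨟ (λ st → (if c st + 3 ≤ᵇ n + 1 then tryForward f s else tick 0) st)
      ⨟ tick 3                                           -- c+1, n+1, comparison
      ⨟ (λ st → (if c st + 1 ≤ᵇ n + 1 then tryClosedBlack f s else tick 0) st)
      ⨟ (λ st → forEach f s (S st) st)

    -- for each t in (the stack as it is when the loop starts):
    --   Mask(t); TryBackward(s,t); Reveal(t)
    forEach : ℕ → ℕ → List ℕ → Comp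
    forEach f s [] = tick 0
    forEach f s (t ∷ ts) =
      tick 1                                             -- iteration step
      ⨟ (λ st → let pos = removeFirst t (S st) in
           (act 1 (λ s' → record s' { S = Data.Product.proj₂ pos })
            ⨟ tryBackward f s t
            ⨟ act 1 (λ s' → record s' { S = insertAt (Data.Product.proj₁ pos) t (S s') }))
           st)
      ⨟ forEach f s ts

    tryClosedWhite : ℕ → ℕ → Comp
    tryClosedWhite f s =
      act 2 (λ st → record st { s1 = upd (s1 st) s s })   -- call, assignment
      ⨟ recurse f

    tryForward : ℕ → ℕ → Comp
    tryForward f s =
      act 1 (λ st → st)                                   -- call
      ⨟ act 2 (λ st → record st { s0 = upd (s0 st) (c st) (c st + 1) })
      ⨟ act 3 (λ st → record st { s0 = upd (s0 st) (c st + 1) (c st + 2) })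
      ⨟ act 2 (λ st → record st { s0 = upd (s0 st) (c st + 2) (c st) })
      ⨟ act 1 (λ st → record st { s1 = upd (s1 st) s (c st) })
      ⨟ act 1 (λ st → record st { s1 = upd (s1 st) (c st) s })
      ⨟ act 2 (λ st → record st { S = (c st + 1) ∷ S st })
      ⨟ act 2 (λ st → record st { S = (c st + 2) ∷ S st })
      ⨟ act 2 (λ st → record st { c = c st + 3 })
      ⨟ recurse f
      ⨟ act 2 (λ st → record st { c = c st ∸ 3 })
      ⨟ act 1 (λ st → record st { S = popS (S st) })
      ⨟ act 1 (λ st → record st { S = popS (S st) })

    tryClosedBlack : ℕ → ℕ → Comp
    tryClosedBlack f s =
      act 1 (λ st → st)                                   -- call
      ⨟ act 1 (λ st → record st { s1 = upd (s1 st) s (c st) })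
      ⨟ act 1 (λ st → record st { s1 = upd (s1 st) (c st) s })
      ⨟ act 1 (λ st → record st { s0 = upd (s0 st) (c st) (c st) })
      ⨟ act 2 (λ st → record st { c = c st + 1 })
      ⨟ recurse f
      ⨟ act 2 (λ st → record st { c = c st ∸ 1 })

    tryBackward : ℕ → ℕ → ℕ → Comp
    tryBackward f s t =
      act 1 (λ st → st)                                   -- call
      ⨟ act 1 (λ st → record st { s1 = upd (s1 st) s t })
      ⨟ act 1 (λ st → record st { s1 = upd (s1 st) t s })
      ⨟ recurse f

  -- fuel: bounds the nesting depth of Recurse calls (the quantity
  -- 3(n+1-c) + |S| strictly decreases along nested calls), so it never
  -- actually runs out.
  fuel : ℕ
  fuel = 3 * n + 10

  generateComp : Comp
  generateComp =
    tick 1                                               -- call of Generate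
    ⨟ tick 1                                             -- comparison n ≥ 1
    ⨟ (if 1 ≤ᵇ n
       then act 1 (λ st → record st { c = 2 })
            ⨟ act 1 (λ st → record st { s0 = upd (s0 st) 1 1 })
            ⨟ dispatch fuel 1
       else tick 0)
    ⨟ tick 1                                             -- comparison n ≥ 3
    ⨟ (if 3 ≤ᵇ n
       then act 1 (λ st → record st { c = 4 })
            ⨟ act 1 (λ st → record st { s0 = upd (s0 st) 1 2 })
            ⨟ act 1 (λ st → record st { s0 = upd (s0 st) 2 3 })
            ⨟ act 1 (λ st → record st { s0 = upd (s0 st) 3 1 })
            ⨟ act 1 (λ st → record st { S = 1 ∷ S st })
            ⨟ act 1 (λ st → record st { S = 2 ∷ S st })
            ⨟ dispatch fuel 3
       else tick 0)

initialState : State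
initialState = mkState 0 (λ _ → 0) (λ _ → 0) []

generate : ℕ → Maybe (ℕ × ℕ)
generate n = Data.Maybe.map forget (Algorithm.generateComp n initialState)
  where
    forget : State × ℕ × ℕ → ℕ × ℕ
    forget (_ , T , O) = T , O

module Submission where

-- Amortised analysis, charging 37 time units to each call of Output.  Every call of
-- Recurse outputs at least once: at once if the stack is empty, otherwise through the
-- TryClosedWhite branch of its Dispatch.  Each call of Recurse ends with 20 units of its
-- charge unspent (34 when it outputs at once) and each Dispatch with 25.  Dispatch spends
-- 9 units itself; they are paid by its TryClosedWhite call together with either the 14
-- units left by each backtracking iteration (which spends 6 around its Recurse) or, on an
-- empty stack, the surplus of an immediate output.  TryForward and TryClosedBlack spend 20
-- and 8 units around their Recurse.  Every procedure returns with the counter c and the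
-- stack S it was called with, and 3(n + 1 - c) + |S| drops at each Pop and never grows
-- otherwise, so the fuel 3n + 10 is never exhausted.

open import Defs
open import Data.Bool using (true; false; T; not; if_then_else_)
open import Data.Empty using (⊥-elim)
open import Data.List using (List; []; _∷_; length)
open import Data.List.Membership.Propositional using (_∈_)
open import Data.List.Relation.Unary.Any using (here; there)
open import Data.Maybe using (just)
import Data.Maybe
open import Data.Nat using (ℕ; zero; suc; _+_; _*_; _∸_; _≤_; _<_; _≤ᵇ_; _≡ᵇ_; z≤n; s≤s)
open import Data.Nat.Properties
open import Data.Nat.Tactic.RingSolver using (solve-∀)
open import Algebra.Properties.CommutativeSemigroup +-commutativeSemigroup using (interchange; xy∙z≈x∙zy)
open import Data.Product using (Σ; _×_; _,_; proj₁; proj₂)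
open import Data.Unit using (⊤; tt)
open import Function using (_∘_; _$_)
open import Relation.Binary.PropositionalEquality using (_≡_; refl; sym; trans; cong; subst; subst₂)

module Amortised (K : ℕ) where

  record Run (p : Comp) (st : State) (credit overhead : ℕ) (Post : State → Set) : Set where
    constructor run
    field
      final : State
      time outputs : ℕ
      evaluates : p st ≡ just (final , time , outputs)
      bounded : time + credit ≤ K * outputs + overhead
      post : Post final

  private
    variable
      p q : Comp
      st : State
      a a₁ a₂ b b₁ b₂ : ℕ
      P Q : State → Set

  ⨟-evaluates : ∀ p q {st st₁ st₂ t₁ t₂ o₁ o₂} → p st ≡ just (st₁ , t₁ , o₁) → q st₁ ≡ just (st₂ , t₂ , o₂) →
                (p ⨟ q) st ≡ just (st₂ , t₁ + t₂ , o₁ + o₂)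
  ⨟-evaluates p q e₁ e₂ rewrite e₁ | e₂ = refl

  bound-+ : ∀ t₁ t₂ o₁ o₂ → t₁ + a₁ ≤ K * o₁ + b₁ → t₂ + a₂ ≤ K * o₂ + b₂ →
            (t₁ + t₂) + (a₁ + a₂) ≤ K * (o₁ + o₂) + (b₁ + b₂)
  bound-+ {a₁} {b₁} {a₂} {b₂} t₁ t₂ o₁ o₂ h₁ h₂ =
    subst₂ _≤_ (interchange t₁ a₁ t₂ a₂)
               (trans (interchange (K * o₁) b₁ (K * o₂) b₂) (cong (_+ (b₁ + b₂)) (sym (*-distribˡ-+ K o₁ o₂))))
               (+-mono-≤ h₁ h₂)

  infixr 3 _⨾_
  _⨾_ : Run p st a₁ b₁ P → (∀ {st′} → P st′ → Run q st′ a₂ b₂ Q) → Run (p ⨟ q) st (a₁ + a₂) (b₁ + b₂) Q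
  _⨾_ {p = p} {q = q} (run _ t₁ o₁ e₁ h₁ post₁) k with k post₁
  ... | run st₂ t₂ o₂ e₂ h₂ post₂ = run st₂ _ _ (⨟-evaluates p q e₁ e₂) (bound-+ t₁ t₂ o₁ o₂ h₁ h₂) post₂

  act-run : ∀ {k g} → Q (g st) → Run (act k g) st 0 k Q
  act-run {k = k} post = run _ k 0 refl (≤-reflexive (trans (+-identityʳ k) (cong (_+ k) (sym (*-zeroʳ K))))) post

  -- g cannot be left to unification: act k g ⨟ q reduces, so its shape is lost.
  act-⨾ : ∀ k g → Run q (g st) a b Q → Run (act k g ⨟ q) st a (k + b) Q
  act-⨾ k g r = act-run {Q = _≡ g _} {k = k} {g = g} refl ⨾ λ { refl → r }

  tick-⨾ : ∀ k → Run q st a b Q → Run (tick k ⨟ q) st a (k + b) Q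
  tick-⨾ k = act-⨾ k (λ st → st)

  pay-overhead : ∀ a′ → b + a′ ≤ a → Run p st a b Q → Run p st a′ 0 Q
  pay-overhead {b} {a} a′ w (run st′ t o e h post) = run st′ t o e (+-cancelʳ-≤ b _ _ shifted) post
    where
    open ≤-Reasoning
    shifted : (t + a′) + b ≤ (K * o + 0) + b
    shifted = begin
      (t + a′) + b     ≡⟨ xy∙z≈x∙zy t a′ b ⟩
      t + (b + a′)     ≤⟨ +-monoʳ-≤ t w ⟩
      t + a            ≤⟨ h ⟩
      K * o + b        ≡⟨ cong (_+ b) (sym (+-identityʳ (K * o))) ⟩
      (K * o + 0) + b  ∎

  map-post : (∀ {x} → P x → Q x) → Run p st a b P → Run p st a b Q
  map-post f (run st′ t o e h post) = run st′ t o e h (f post)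

  unfold : ∀ {p′} → p st ≡ p′ st → Run p′ st a b Q → Run p st a b Q
  unfold e′ (run st′ t o e h post) = run st′ t o (trans e′ e) h post

  Run-if : ∀ β {p q} → (T β → Run p st a b Q) → (T (not β) → Run q st a b Q) → Run (if β then p else q) st a b Q
  Run-if true  r _ = r _
  Run-if false _ r = r _

  Run-if-true : ∀ {β} → T β → Run p st a b Q → Run (if β then p else q) st a b Q
  Run-if-true {β = true} _ r = r

removeFirst-length : ∀ t xs → length (proj₂ (removeFirst t xs)) ≤ length xs
removeFirst-length t [] = z≤n
removeFirst-length t (x ∷ xs) with t ≡ᵇ x
... | true = n≤1+n _
... | false with removeFirst t xs | removeFirst-length t xs
...   | _ , ys | shorter = s≤s shorter

insertAt-removeFirst : ∀ {t xs} → t ∈ xs → insertAt (proj₁ (removeFirst t xs)) t (proj₂ (removeFirst t xs)) ≡ xs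
insertAt-removeFirst {t} {x ∷ xs} t∈ with t ≡ᵇ x in t≟x
... | true = cong (_∷ xs) (≡ᵇ⇒≡ t x (subst T (sym t≟x) tt))
... | false with t∈
...   | here refl = ⊥-elim (subst T t≟x (≡⇒≡ᵇ t t refl))
...   | there t∈xs with removeFirst t xs | insertAt-removeFirst t∈xs
...     | _ , ys | reinserted = cong (x ∷_) reinserted

record Framed (c₀ : ℕ) (S₀ : List ℕ) (st : State) : Set where
  constructor framed
  field
    c-≡ : State.c st ≡ c₀
    S-≡ : State.S st ≡ S₀

module Analysis (n : ℕ) where
  open Algorithm n
  open Amortised 37
  open State

  weight : ℕ → List ℕ → ℕ
  weight c₀ S₀ = 3 * (n + 1 ∸ c₀) + length S₀

  weight-pop : ∀ c₀ k S₀ → weight c₀ (k ∷ S₀) ≡ suc (weight c₀ S₀)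
  weight-pop c₀ k S₀ = +-suc (3 * (n + 1 ∸ c₀)) (length S₀)

  weight-forward : ∀ c₀ S₀ → c₀ + 3 ≤ n + 1 → weight (c₀ + 3) ((c₀ + 2) ∷ (c₀ + 1) ∷ S₀) ≤ weight c₀ S₀
  weight-forward c₀ S₀ room = begin
    3 * x + (2 + l)      ≤⟨ m≤n+m _ 7 ⟩
    7 + (3 * x + (2 + l)) ≡⟨ expand x l ⟩
    3 * (3 + x) + l      ≡⟨ cong (λ y → 3 * y + l) (sym gap) ⟩
    weight c₀ S₀         ∎
    where
    open ≤-Reasoning
    x = n + 1 ∸ (c₀ + 3)
    l = length S₀
    gap : n + 1 ∸ c₀ ≡ 3 + x
    gap = trans (cong (_∸ c₀) (trans (sym (m+[n∸m]≡n room)) (+-assoc c₀ 3 x))) (m+n∸m≡n c₀ (3 + x))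
    expand : ∀ x l → 7 + (3 * x + (2 + l)) ≡ 3 * (3 + x) + l
    expand = solve-∀

  weight-closedBlack : ∀ c₀ S₀ → weight (c₀ + 1) S₀ ≤ weight c₀ S₀
  weight-closedBlack c₀ S₀ = +-monoˡ-≤ (length S₀) (*-monoʳ-≤ 3 (∸-monoʳ-≤ (n + 1) (m≤m+n c₀ 1)))

  weight-mask : ∀ c₀ t S₀ → weight c₀ (proj₂ (removeFirst t S₀)) ≤ weight c₀ S₀
  weight-mask c₀ t S₀ = +-monoʳ-≤ (3 * (n + 1 ∸ c₀)) (removeFirst-length t S₀)

  weight<fuel : ∀ c₀ S₀ → length S₀ ≤ 6 → weight c₀ S₀ < fuel
  weight<fuel c₀ S₀ short =
    ≤-trans (s≤s (+-mono-≤ (*-monoʳ-≤ 3 (m∸n≤m (n + 1) c₀)) short)) (≤-reflexive (tally n))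
    where
    tally : ∀ n → suc (3 * (n + 1) + 6) ≡ 3 * n + 10
    tally = solve-∀

  recurseCredit : List ℕ → ℕ
  recurseCredit []      = 34
  recurseCredit (_ ∷ _) = 20

  20≤recurseCredit : ∀ S₀ → 20 ≤ recurseCredit S₀
  20≤recurseCredit []      = ≤ᵇ⇒≤ 20 34 tt
  20≤recurseCredit (_ ∷ _) = ≤-refl

  dispatch-credit : ∀ S₀ → 34 ≤ recurseCredit S₀ + length S₀ * 14
  dispatch-credit []       = ≤-refl
  dispatch-credit (_ ∷ S₀) = m≤m+n 34 (length S₀ * 14)

  mutual
    recurse-run : ∀ f {c₀ S₀} → weight c₀ S₀ < f → ∀ {st} → Framed c₀ S₀ st →
                  Run (recurse f) st (recurseCredit S₀) 0 (Framed c₀ S₀)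
    recurse-run zero () _
    recurse-run (suc f) {S₀ = []} _ {mkState _ _ _ _} fr@(framed refl refl) =
      run _ 3 1 refl ≤-refl fr
    recurse-run (suc f) {c₀} {k ∷ S₀} w {mkState _ _ _ _} (framed refl refl) =
      unfold refl $ pay-overhead 20 ≤-refl $
      act-⨾ 4 (λ st → record st { S = S₀ }) $
      dispatch-run f k (≤-pred (subst (_< suc f) (weight-pop c₀ k S₀) w)) (framed refl refl) ⨾ λ (framed c≡ S≡) →
      act-run (framed c≡ (cong (k ∷_) S≡))

    dispatch-run : ∀ f s {c₀ S₀} → weight c₀ S₀ < f → ∀ {st} → Framed c₀ S₀ st →
                   Run (dispatch f s) st 25 0 (Framed c₀ S₀)
    dispatch-run f s {S₀ = S₀} w (framed refl refl) =
      pay-overhead 25 (dispatch-credit S₀) $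
      tick-⨾ 1 $
      act-⨾ 2 (λ st → record st { s1 = upd (s1 st) s s }) (recurse-run f w (framed refl refl)) ⨾ λ fr₁ →
      tick-⨾ 3 $ guardedTryForward-run f s w fr₁ ⨾ λ fr₂ →
      tick-⨾ 3 $ guardedTryClosedBlack-run f s w fr₂ ⨾ λ fr₃ →
      forEachInStack-run f s w fr₃

    guardedTryForward-run : ∀ f s {c₀ S₀} → weight c₀ S₀ < f → ∀ {st} → Framed c₀ S₀ st →
      Run (λ x → (if c x + 3 ≤ᵇ n + 1 then tryForward f s else tick 0) x) st 0 0 (Framed c₀ S₀)
    guardedTryForward-run f s w {st} fr@(framed refl refl) = unfold refl $
      Run-if (c st + 3 ≤ᵇ n + 1) (λ room → tryForward-run f s w (≤ᵇ⇒≤ _ _ room) fr) (λ _ → act-run fr)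

    tryForward-run : ∀ f s {c₀ S₀} → weight c₀ S₀ < f → c₀ + 3 ≤ n + 1 → ∀ {st} → Framed c₀ S₀ st →
                  Run (tryForward f s) st 0 0 (Framed c₀ S₀)
    tryForward-run f s {c₀} {S₀} w room (framed refl refl) =
      pay-overhead 0 ≤-refl $
      tick-⨾ 1 $
      act-⨾ 2 (λ st → record st { s0 = upd (s0 st) (c st) (c st + 1) }) $
      act-⨾ 3 (λ st → record st { s0 = upd (s0 st) (c st + 1) (c st + 2) }) $
      act-⨾ 2 (λ st → record st { s0 = upd (s0 st) (c st + 2) (c st) }) $
      act-⨾ 1 (λ st → record st { s1 = upd (s1 st) s (c st) }) $
      act-⨾ 1 (λ st → record st { s1 = upd (s1 st) (c st) s }) $
      act-⨾ 2 (λ st → record st { S = (c st + 1) ∷ S st }) $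
      act-⨾ 2 (λ st → record st { S = (c st + 2) ∷ S st }) $
      act-⨾ 2 (λ st → record st { c = c st + 3 }) $
      recurse-run f (≤-<-trans (weight-forward c₀ S₀ room) w) (framed refl refl) ⨾ λ (framed c≡ S≡) →
      act-⨾ 2 (λ st → record st { c = c st ∸ 3 }) $
      act-⨾ 1 (λ st → record st { S = popS (S st) }) $
      act-run {g = λ st → record st { S = popS (S st) }} (framed (trans (cong (_∸ 3) c≡) (m+n∸n≡m c₀ 3)) (cong (popS ∘ popS) S≡))

    guardedTryClosedBlack-run : ∀ f s {c₀ S₀} → weight c₀ S₀ < f → ∀ {st} → Framed c₀ S₀ st →
      Run (λ x → (if c x + 1 ≤ᵇ n + 1 then tryClosedBlack f s else tick 0) x) st 0 0 (Framed c₀ S₀)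
    guardedTryClosedBlack-run f s w {st} fr = unfold refl $
      Run-if (c st + 1 ≤ᵇ n + 1) (λ _ → tryClosedBlack-run f s w fr) (λ _ → act-run fr)

    tryClosedBlack-run : ∀ f s {c₀ S₀} → weight c₀ S₀ < f → ∀ {st} → Framed c₀ S₀ st →
                      Run (tryClosedBlack f s) st 0 0 (Framed c₀ S₀)
    tryClosedBlack-run f s {c₀} {S₀} w (framed refl refl) =
      pay-overhead 0 (≤ᵇ⇒≤ 8 20 tt) $
      tick-⨾ 1 $
      act-⨾ 1 (λ st → record st { s1 = upd (s1 st) s (c st) }) $
      act-⨾ 1 (λ st → record st { s1 = upd (s1 st) (c st) s }) $
      act-⨾ 1 (λ st → record st { s0 = upd (s0 st) (c st) (c st) }) $
      act-⨾ 2 (λ st → record st { c = c st + 1 }) $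
      pay-overhead 20 (20≤recurseCredit S₀)
        (recurse-run f (≤-<-trans (weight-closedBlack c₀ S₀) w) (framed refl refl)) ⨾ λ (framed c≡ S≡) →
      act-run (framed (trans (cong (_∸ 1) c≡) (m+n∸n≡m c₀ 1)) S≡)

    forEachInStack-run : ∀ f s {c₀ S₀} → weight c₀ S₀ < f → ∀ {st} → Framed c₀ S₀ st →
                     Run (λ x → forEach f s (S x) x) st (length S₀ * 14) 0 (Framed c₀ S₀)
    forEachInStack-run f s w fr@(framed refl refl) = unfold refl (forEach-run f s w _ (λ t∈ → t∈) fr)

    forEach-run : ∀ f s {c₀ S₀} → weight c₀ S₀ < f → ∀ ts → (∀ {t} → t ∈ ts → t ∈ S₀) → ∀ {st} → Framed c₀ S₀ st →
               Run (forEach f s ts) st (length ts * 14) 0 (Framed c₀ S₀)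
    forEach-run f s w [] _ fr = act-run fr
    forEach-run f s w (t ∷ ts) ts⊆S₀ fr =
      pay-overhead _ ≤-refl $
      tick-⨾ 1 $ maskTryBackwardReveal-run f s w (ts⊆S₀ (here refl)) fr ⨾ λ fr′ →
      forEach-run f s w ts (ts⊆S₀ ∘ there) fr′

    maskTryBackwardReveal-run : ∀ f s {c₀ S₀ t} → weight c₀ S₀ < f → t ∈ S₀ → ∀ {st} → Framed c₀ S₀ st →
      Run (λ x → (act 1 (λ y → record y { S = proj₂ (removeFirst t (S x)) })
                  ⨟ tryBackward f s t
                  ⨟ act 1 (λ y → record y { S = insertAt (proj₁ (removeFirst t (S x))) t (S y) })) x)
          st 20 5 (Framed c₀ S₀)
    maskTryBackwardReveal-run f s {c₀} {S₀} {t} w t∈S₀ (framed refl refl) =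
      unfold refl $
      act-⨾ 1 (λ y → record y { S = proj₂ (removeFirst t S₀) }) $
      tryBackward-run f s t (≤-<-trans (weight-mask c₀ t S₀) w) (framed refl refl) ⨾ λ (framed c≡ S≡) →
      act-run (framed c≡ (trans (cong (insertAt _ t) S≡) (insertAt-removeFirst t∈S₀)))

    tryBackward-run : ∀ f s t {c₀ S₀} → weight c₀ S₀ < f → ∀ {st} → Framed c₀ S₀ st →
                   Run (tryBackward f s t) st 20 3 (Framed c₀ S₀)
    tryBackward-run f s t {S₀ = S₀} w (framed refl refl) =
      tick-⨾ 1 $
      act-⨾ 1 (λ st → record st { s1 = upd (s1 st) s t }) $
      act-⨾ 1 (λ st → record st { s1 = upd (s1 st) t s }) $
      pay-overhead 20 (20≤recurseCredit S₀) (recurse-run f w (framed refl refl))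

  startOneDart startThreeDarts : Comp
  startOneDart =
    act 1 (λ st → record st { c = 2 }) ⨟ act 1 (λ st → record st { s0 = upd (s0 st) 1 1 }) ⨟ dispatch fuel 1
  startThreeDarts =
    act 1 (λ st → record st { c = 4 }) ⨟ act 1 (λ st → record st { s0 = upd (s0 st) 1 2 })
    ⨟ act 1 (λ st → record st { s0 = upd (s0 st) 2 3 }) ⨟ act 1 (λ st → record st { s0 = upd (s0 st) 3 1 })
    ⨟ act 1 (λ st → record st { S = 1 ∷ S st }) ⨟ act 1 (λ st → record st { S = 2 ∷ S st }) ⨟ dispatch fuel 3

  startOneDart-run : 1 ≤ n → Run (if 1 ≤ᵇ n then startOneDart else tick 0) initialState 25 2 (Framed 2 [])
  startOneDart-run 1≤n =
    Run-if-true (≤⇒≤ᵇ 1≤n) $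
    act-⨾ 1 (λ st → record st { c = 2 }) $
    act-⨾ 1 (λ st → record st { s0 = upd (s0 st) 1 1 }) $
    dispatch-run fuel 1 (weight<fuel 2 [] z≤n) (framed refl refl)

  startThreeDarts-run : ∀ {st} → Framed 2 [] st → Run (if 3 ≤ᵇ n then startThreeDarts else tick 0) st 0 0 (λ _ → ⊤)
  startThreeDarts-run (framed _ S≡) = Run-if (3 ≤ᵇ n) started (λ _ → act-run tt)
    where
    started : T (3 ≤ᵇ n) → Run startThreeDarts _ 0 0 (λ _ → ⊤)
    started _ =
      map-post (λ _ → tt) $ pay-overhead 0 (≤ᵇ⇒≤ 6 25 tt) $
      act-⨾ 1 (λ st → record st { c = 4 }) $
      act-⨾ 1 (λ st → record st { s0 = upd (s0 st) 1 2 }) $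
      act-⨾ 1 (λ st → record st { s0 = upd (s0 st) 2 3 }) $
      act-⨾ 1 (λ st → record st { s0 = upd (s0 st) 3 1 }) $
      act-⨾ 1 (λ st → record st { S = 1 ∷ S st }) $
      act-⨾ 1 (λ st → record st { S = 2 ∷ S st }) $
      dispatch-run fuel 3 (weight<fuel 4 (2 ∷ 1 ∷ []) (≤ᵇ⇒≤ 2 6 tt)) (framed refl (cong (λ L → 2 ∷ 1 ∷ L) S≡))

  generate-run : 1 ≤ n → Run generateComp initialState 0 0 (λ _ → ⊤)
  generate-run 1≤n =
    pay-overhead 0 (≤ᵇ⇒≤ 5 25 tt) $
    tick-⨾ 1 $ tick-⨾ 1 $ startOneDart-run 1≤n ⨾ λ fr →
    tick-⨾ 1 $ startThreeDarts-run fr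

theorem3p6 : Σ ℕ λ K → (n : ℕ) → 1 ≤ n →
             Σ ℕ λ T → Σ ℕ λ O → (generate n ≡ just (T , O)) × (T ≤ K * O)
theorem3p6 = 37 , λ n 1≤n → cost-bound n (Analysis.generate-run n 1≤n)
  where
  open Amortised 37
  cost-bound : ∀ n {Q} → Run (Algorithm.generateComp n) initialState 0 0 Q →
            Σ ℕ λ T → Σ ℕ λ O → (generate n ≡ just (T , O)) × (T ≤ 37 * O)
  cost-bound n (run _ T O e h _) =
    T , O , cong (Data.Maybe.map _) e , subst₂ _≤_ (+-identityʳ T) (+-identityʳ (37 * O)) h
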